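{- For all integers $k\ge1$ and $n\ge0$, $$2^{(k-1)\lfloor\log_2(\lfloor 2n/k\rfloor+1)\rfloor}\le a_k(\lfloor 2n/k\rfloor)\le A_k(n)\le a_k(n)\le 2^{(k-1)\lceil\log_2(n+1)\rceil}.$$
   Context: A P-position of the game of Nim with $k$ piles is a $k$-tuple $(p_1,\dots,p_k)$ of non-negative integers whose nim-sum $p_1\oplus\cdots\oplus p_k$ is $0$, where $\oplus$ denotes bitwise XOR. $a_k(m)$ is the number of P-positions with $k$ piles in which every pile has at most $m$ counters; $A_k(n)$ is the number of P-positions with $k$ piles whose total number of counters is at most $2n$. -}

module Defs where

open import Data.Nat using (ℕ; zero; suc; _+_; _*_; _≤_; _≤?_; _≟_)
open import Data.Nat.DivMod using (_/_; _%_)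
open import Data.Bool using (Bool; true; false; if_then_else_)
open import Data.List using (List; []; _∷_; map; concatMap; upTo; filter; length)
open import Data.Vec using (Vec; []; _∷_; foldr)
open import Relation.Nullary.Decidable using (_×-dec_)

-- Bitwise XOR of natural numbers, by recursion on a fuel parameter.
-- xorFuel f m n computes the XOR correctly whenever m < 2^f and n < 2^f;
-- fuel m + n always suffices (each step halves both arguments).
xorFuel : ℕ → ℕ → ℕ → ℕ
xorFuel zero    m n = 0
xorFuel (suc f) m n =
  (if (m % 2 Data.Nat.≡ᵇ n % 2) then 0 else 1) + 2 * xorFuel f (m / 2) (n / 2)

infixl 6 _⊕_
_⊕_ : ℕ → ℕ → ℕ
m ⊕ n = xorFuel (m + n) m n

nimSum : ∀ {k} → Vec ℕ k → ℕ
nimSum = foldr _ _⊕_ 0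

total : ∀ {k} → Vec ℕ k → ℕ
total = foldr _ _+_ 0

boxTuples : (k m : ℕ) → List (Vec ℕ k)
boxTuples zero    m = [] ∷ []
boxTuples (suc k) m =
  concatMap (λ x → map (x ∷_) (boxTuples k m)) (upTo (suc m))

a : (k m : ℕ) → ℕ
a k m = length (filter (λ p → nimSum p ≟ 0) (boxTuples k m))

-- A_k(n): number of P-positions with k piles, total number of counters ≤ 2n
-- (such a tuple necessarily has every pile ≤ 2n)
A : (k n : ℕ) → ℕ
A k n = length (filter (λ p → (nimSum p ≟ 0) ×-dec (total p ≤? 2 * n))
                       (boxTuples k (2 * n)))

-- A P-position is determined by all but its first pile, the first pile being the nim-sum of the
-- others; so a_k(m) counts the (k−1)-tuples in [0,m] whose nim-sum is at most m. That is at most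
-- (m+1)^(k−1), and at least 2^(f(k−1)) when 2^f ≤ m+1, because numbers below 2^f have nim-sum below
-- 2^f. For the middle inequalities, piles of size at most 2n/k have total at most 2n; and in a
-- P-position each pile is the nim-sum of the others, hence at most their total, so a total of at
-- most 2n forces every pile to be at most n. All counts compare duplicate-free lists by inclusion.
module Submission where

open import Defs
open import Data.Nat using (ℕ; NonZero; _+_; _*_; _∸_; _^_; _≤_; _/_)
open import Data.Nat.Logarithm using (⌊log₂_⌋; ⌈log₂_⌉)
open import Data.Product using (_×_)

open import Data.Bool using (true; false; if_then_else_)
open import Data.Empty using (⊥-elim)
open import Data.List using (List; []; _∷_; _++_; map; concatMap; cartesianProductWith; upTo; filter; length)
open import Data.List.Membership.Propositional using (_∈_; _─_)
open import Data.List.Membership.Propositional.Properties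
  using (∈-map⁺; ∈-map⁻; ∈-filter⁺; ∈-filter⁻; ∈-upTo⁺; ∈-upTo⁻; ∈-cartesianProductWith⁺; ∈-cartesianProductWith⁻)
open import Data.List.Properties using (length-map; length-++; length-upTo; length-removeAt′)
open import Data.List.Relation.Binary.Subset.Propositional using (_⊆_)
open import Data.List.Relation.Unary.Any using (here; there; index)
import Data.List.Relation.Unary.All as List
open import Data.List.Relation.Unary.Unique.Propositional using (Unique; []; _∷_)
open import Data.List.Relation.Unary.Unique.Propositional.Properties as Unique using (upTo⁺)
open import Data.Nat using (zero; suc; pred; _<_; _%_; _≡ᵇ_; _≟_; _≤?_; z≤n; s≤s; ⌊_/2⌋; ⌈_/2⌉)
open import Data.Nat.DivMod using (m≡m%n+[m/n]*n; m%n<n; m/n<m; m<n*o⇒m/o<n; m/n*n≤m)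
open import Data.Nat.Logarithm.Core using (⌊log2⌋; ⌈log2⌉)
open import Data.Nat.Properties
open import Data.Nat.Tactic.RingSolver using (solve-∀)
open import Data.Product using (_,_)
open import Data.Vec using (Vec; []; _∷_)
open import Data.Vec.Properties using (∷-injective; ∷-injectiveʳ)
open import Data.Vec.Relation.Unary.All using (All; []; _∷_)
import Data.Vec.Relation.Unary.All as All
open import Data.Nat.Induction using (<-wellFounded)
open import Induction.WellFounded using (Acc; acc)
open import Relation.Binary.PropositionalEquality
open import Relation.Nullary.Decidable using (_×-dec_)
open import Relation.Unary using (Pred; Decidable)

open ≤-Reasoning

pattern 0<2 = s≤s z≤n
pattern 1<2 = s≤s (s≤s z≤n)

m≡m%2+2*[m/2] : ∀ m → m ≡ m % 2 + 2 * (m / 2)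
m≡m%2+2*[m/2] m = trans (m≡m%n+[m/n]*n m 2) (cong (m % 2 +_) (*-comm (m / 2) 2))

m≤1+n⇒m/2≤n : ∀ {m n} → m ≤ suc n → m / 2 ≤ n
m≤1+n⇒m/2≤n {zero}  _  = z≤n
m≤1+n⇒m/2≤n {suc m} m≤ = ≤-pred (<-≤-trans (m/n<m (suc m) 2 1<2) m≤)

m<2^[1+n]⇒m/2<2^n : ∀ {m} n → m < 2 ^ suc n → m / 2 < 2 ^ n
m<2^[1+n]⇒m/2<2^n n m< = m<n*o⇒m/o<n (<-≤-trans m< (≤-reflexive (*-comm 2 (2 ^ n))))

binary-≤-+ : ∀ {u u′} v v′ w w′ → u ≤ v + w → u′ ≤ v′ + w′ →
             u + 2 * u′ ≤ (v + 2 * v′) + (w + 2 * w′)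
binary-≤-+ {u} {u′} v v′ w w′ u≤ u′≤ = begin
  u + 2 * u′                    ≤⟨ +-mono-≤ u≤ (*-monoʳ-≤ 2 u′≤) ⟩
  (v + w) + 2 * (v′ + w′)       ≡⟨ regroup v w v′ w′ ⟩
  (v + 2 * v′) + (w + 2 * w′)   ∎
  where
  regroup : ∀ v w v′ w′ → (v + w) + 2 * (v′ + w′) ≡ (v + 2 * v′) + (w + 2 * w′)
  regroup = solve-∀

b+2*m<2*n : ∀ {b m n} → b ≤ 1 → m < n → b + 2 * m < 2 * n
b+2*m<2*n {b} {m} {n} b≤1 m<n = begin-strict
  b + 2 * m      <⟨ s≤s (+-monoˡ-≤ (2 * m) b≤1) ⟩
  2 + 2 * m      ≡⟨ *-suc 2 m ⟨
  2 * suc m      ≤⟨ *-monoʳ-≤ 2 m<n ⟩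
  2 * n          ∎

2*⌊n/2⌋≤n : ∀ n → 2 * ⌊ n /2⌋ ≤ n
2*⌊n/2⌋≤n n = begin
  2 * ⌊ n /2⌋           ≡⟨ cong (⌊ n /2⌋ +_) (+-identityʳ ⌊ n /2⌋) ⟩
  ⌊ n /2⌋ + ⌊ n /2⌋     ≤⟨ +-monoʳ-≤ ⌊ n /2⌋ (⌊n/2⌋≤⌈n/2⌉ n) ⟩
  ⌊ n /2⌋ + ⌈ n /2⌉     ≡⟨ ⌊n/2⌋+⌈n/2⌉≡n n ⟩
  n                     ∎

n≤2*⌈n/2⌉ : ∀ n → n ≤ 2 * ⌈ n /2⌉
n≤2*⌈n/2⌉ n = begin
  n                     ≡⟨ ⌊n/2⌋+⌈n/2⌉≡n n ⟨
  ⌊ n /2⌋ + ⌈ n /2⌉     ≤⟨ +-monoˡ-≤ ⌈ n /2⌉ (⌊n/2⌋≤⌈n/2⌉ n) ⟩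
  ⌈ n /2⌉ + ⌈ n /2⌉     ≡⟨ cong (⌈ n /2⌉ +_) (+-identityʳ ⌈ n /2⌉) ⟨
  2 * ⌈ n /2⌉           ∎

2^⌊log₂[1+n]⌋≤1+n : ∀ n → 2 ^ ⌊log₂ (suc n) ⌋ ≤ suc n
2^⌊log₂[1+n]⌋≤1+n n = go n (<-wellFounded (suc n))
  where
  go : ∀ n (rec : Acc _<_ (suc n)) → 2 ^ ⌊log2⌋ (suc n) rec ≤ suc n
  go zero    _        = ≤-refl
  go (suc n) (acc _) = begin
    2 * 2 ^ ⌊log2⌋ (suc ⌊ n /2⌋) _   ≤⟨ *-monoʳ-≤ 2 (go ⌊ n /2⌋ _) ⟩
    2 * suc ⌊ n /2⌋                  ≡⟨ *-suc 2 ⌊ n /2⌋ ⟩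
    2 + 2 * ⌊ n /2⌋                  ≤⟨ +-monoʳ-≤ 2 (2*⌊n/2⌋≤n n) ⟩
    2 + n                            ∎

n≤2^⌈log₂n⌉ : ∀ n → n ≤ 2 ^ ⌈log₂ n ⌉
n≤2^⌈log₂n⌉ n = go n (<-wellFounded n)
  where
  go : ∀ n (rec : Acc _<_ n) → n ≤ 2 ^ ⌈log2⌉ n rec
  go zero          _        = z≤n
  go (suc zero)    _        = ≤-refl
  go (suc (suc n)) (acc _) = begin
    2 + n                            ≤⟨ +-monoʳ-≤ 2 (n≤2*⌈n/2⌉ n) ⟩
    2 + 2 * ⌈ n /2⌉                  ≡⟨ *-suc 2 ⌈ n /2⌉ ⟨
    2 * suc ⌈ n /2⌉                  ≤⟨ *-monoʳ-≤ 2 (go (suc ⌈ n /2⌉) _) ⟩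
    2 * 2 ^ ⌈log2⌉ (suc ⌈ n /2⌉) _   ∎

2^[m*n]≡[2^n]^m : ∀ m n → 2 ^ (m * n) ≡ (2 ^ n) ^ m
2^[m*n]≡[2^n]^m m n = trans (cong (2 ^_) (*-comm m n)) (sym (^-*-assoc 2 n m))

module _ {a} {A : Set a} where

  ∈-─⁺ : ∀ {x y : A} {ys} (x∈ys : x ∈ ys) → y ∈ ys → y ≢ x → y ∈ ys ─ x∈ys
  ∈-─⁺ (here refl)  (here refl)  y≢x = ⊥-elim (y≢x refl)
  ∈-─⁺ (here refl)  (there y∈ys) _   = y∈ys
  ∈-─⁺ (there x∈ys) (here refl)  _   = here refl
  ∈-─⁺ (there x∈ys) (there y∈ys) y≢x = there (∈-─⁺ x∈ys y∈ys y≢x)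

  Unique∧⊆⇒length≤ : ∀ {xs ys : List A} → Unique xs → xs ⊆ ys → length xs ≤ length ys
  Unique∧⊆⇒length≤ {[]}          _             _     = z≤n
  Unique∧⊆⇒length≤ {x ∷ xs} {ys} (x∉xs ∷ uniq) xs⊆ys = begin
    suc (length xs)            ≤⟨ s≤s (Unique∧⊆⇒length≤ uniq xs⊆ys─x) ⟩
    suc (length (ys ─ x∈ys))   ≡⟨ length-removeAt′ ys (index x∈ys) ⟨
    length ys                  ∎
    where
    x∈ys = xs⊆ys (here refl)
    xs⊆ys─x : xs ⊆ ys ─ x∈ys
    xs⊆ys─x y∈xs = ∈-─⁺ x∈ys (xs⊆ys (there y∈xs)) (≢-sym (List.lookup x∉xs y∈xs))

  concatMap≡cartesianProductWith : ∀ {b c} {B : Set b} {C : Set c} (f : A → B → C) xs ys →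
    concatMap (λ x → map (f x) ys) xs ≡ cartesianProductWith f xs ys
  concatMap≡cartesianProductWith f []       ys = refl
  concatMap≡cartesianProductWith f (x ∷ xs) ys = cong (map (f x) ys ++_) (concatMap≡cartesianProductWith f xs ys)

  length-cartesianProductWith : ∀ {b c} {B : Set b} {C : Set c} (f : A → B → C) xs ys →
    length (cartesianProductWith f xs ys) ≡ length xs * length ys
  length-cartesianProductWith f []       ys = refl
  length-cartesianProductWith f (x ∷ xs) ys =
    trans (length-++ (map (f x) ys))
          (cong₂ _+_ (length-map (f x) ys) (length-cartesianProductWith f xs ys))

bitXor : ℕ → ℕ → ℕ
bitXor r s = if r ≡ᵇ s then 0 else 1

bitXor-self : ∀ r → bitXor r r ≡ 0
bitXor-self zero    = refl
bitXor-self (suc r) = bitXor-self r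

bitXor-comm : ∀ r s → bitXor r s ≡ bitXor s r
bitXor-comm zero    zero    = refl
bitXor-comm zero    (suc s) = refl
bitXor-comm (suc r) zero    = refl
bitXor-comm (suc r) (suc s) = bitXor-comm r s

bitXor≤1 : ∀ r s → bitXor r s ≤ 1
bitXor≤1 r s with r ≡ᵇ s
... | true  = z≤n
... | false = ≤-refl

bitXor-triangle : ∀ {r s} → r < 2 → s < 2 → r ≤ bitXor r s + s
bitXor-triangle 0<2 _   = z≤n
bitXor-triangle 1<2 0<2 = ≤-refl
bitXor-triangle 1<2 1<2 = ≤-refl

bitXor≤+ : ∀ {r s} → r < 2 → s < 2 → bitXor r s ≤ r + s
bitXor≤+ 0<2 0<2 = z≤n
bitXor≤+ 0<2 1<2 = ≤-refl
bitXor≤+ 1<2 0<2 = ≤-refl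
bitXor≤+ 1<2 1<2 = z≤n

xorFuel-self : ∀ f x → xorFuel f x x ≡ 0
xorFuel-self zero    x = refl
xorFuel-self (suc f) x = cong₂ (λ b R → b + 2 * R) (bitXor-self (x % 2)) (xorFuel-self f (x / 2))

xorFuel-comm : ∀ f x z → xorFuel f x z ≡ xorFuel f z x
xorFuel-comm zero    x z = refl
xorFuel-comm (suc f) x z =
  cong₂ (λ b R → b + 2 * R) (bitXor-comm (x % 2) (z % 2)) (xorFuel-comm f (x / 2) (z / 2))

xorFuel≤+ : ∀ f x z → xorFuel f x z ≤ x + z
xorFuel≤+ zero    x z = z≤n
xorFuel≤+ (suc f) x z = begin
  xorFuel (suc f) x z                            ≤⟨ binary-≤-+ (x % 2) (x / 2) (z % 2) (z / 2) low high ⟩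
  (x % 2 + 2 * (x / 2)) + (z % 2 + 2 * (z / 2))  ≡⟨ cong₂ _+_ (m≡m%2+2*[m/2] x) (m≡m%2+2*[m/2] z) ⟨
  x + z                                          ∎
  where
  low  = bitXor≤+ (m%n<n x 2) (m%n<n z 2)
  high = xorFuel≤+ f (x / 2) (z / 2)

xorFuel<2^ : ∀ f g {x z} → x < 2 ^ g → z < 2 ^ g → xorFuel f x z < 2 ^ g
xorFuel<2^ zero    g       _         _         = m^n>0 2 g
xorFuel<2^ (suc f) zero    (s≤s z≤n) (s≤s z≤n) = s≤s (≤-reflexive (xorFuel-self (suc f) 0))
xorFuel<2^ (suc f) (suc g) {x} {z} x< z< =
  b+2*m<2*n (bitXor≤1 (x % 2) (z % 2))
    (xorFuel<2^ f g (m<2^[1+n]⇒m/2<2^n g x<) (m<2^[1+n]⇒m/2<2^n g z<))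

xorFuel-triangle : ∀ f {x z} → x ≤ f → z ≤ f → x ≤ xorFuel f x z + z
xorFuel-triangle zero    z≤n _ = z≤n
xorFuel-triangle (suc f) {x} {z} x≤f z≤f = begin
  x                                            ≡⟨ m≡m%2+2*[m/2] x ⟩
  x % 2 + 2 * (x / 2)                          ≤⟨ binary-≤-+ b R (z % 2) (z / 2) low high ⟩
  (b + 2 * R) + (z % 2 + 2 * (z / 2))          ≡⟨ cong ((b + 2 * R) +_) (m≡m%2+2*[m/2] z) ⟨
  xorFuel (suc f) x z + z                      ∎
  where
  b    = bitXor (x % 2) (z % 2)
  R    = xorFuel f (x / 2) (z / 2)
  low  = bitXor-triangle (m%n<n x 2) (m%n<n z 2)
  high = xorFuel-triangle f (m≤1+n⇒m/2≤n x≤f) (m≤1+n⇒m/2≤n z≤f)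

⊕-self : ∀ x → x ⊕ x ≡ 0
⊕-self x = xorFuel-self (x + x) x

⊕-comm : ∀ x z → x ⊕ z ≡ z ⊕ x
⊕-comm x z = trans (cong (λ f → xorFuel f x z) (+-comm x z)) (xorFuel-comm (z + x) x z)

⊕≤+ : ∀ x z → x ⊕ z ≤ x + z
⊕≤+ x z = xorFuel≤+ (x + z) x z

⊕<2^ : ∀ g {x z} → x < 2 ^ g → z < 2 ^ g → x ⊕ z < 2 ^ g
⊕<2^ g {x} {z} = xorFuel<2^ (x + z) g

⊕-triangleˡ : ∀ x z → x ≤ x ⊕ z + z
⊕-triangleˡ x z = xorFuel-triangle (x + z) (m≤m+n x z) (m≤n+m z x)

⊕-triangleʳ : ∀ x z → z ≤ x ⊕ z + x
⊕-triangleʳ x z = subst (λ w → z ≤ w + x) (⊕-comm z x) (⊕-triangleˡ z x)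

⊕≡0⇒≡ : ∀ {x z} → x ⊕ z ≡ 0 → x ≡ z
⊕≡0⇒≡ {x} {z} x⊕z≡0 = ≤-antisym
  (subst (λ w → x ≤ w + z) x⊕z≡0 (⊕-triangleˡ x z))
  (subst (λ w → z ≤ w + x) x⊕z≡0 (⊕-triangleʳ x z))

nimSum≤total : ∀ {k} (s : Vec ℕ k) → nimSum s ≤ total s
nimSum≤total []      = z≤n
nimSum≤total (x ∷ s) = ≤-trans (⊕≤+ x (nimSum s)) (+-monoʳ-≤ x (nimSum≤total s))

nimSum<2^ : ∀ g {k} {s : Vec ℕ k} → All (_< 2 ^ g) s → nimSum s < 2 ^ g
nimSum<2^ g []        = m^n>0 2 g
nimSum<2^ g (x< ∷ s<) = ⊕<2^ g x< (nimSum<2^ g s<)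

-- With X the nim-sum of the other piles, y ≤ (y ⊕ X) + X = nimSum s + X, and X is at most
-- the total of the other piles.
2*pile≤nimSum+total : ∀ {k} (s : Vec ℕ k) → All (λ y → 2 * y ≤ nimSum s + total s) s
2*pile≤nimSum+total []      = []
2*pile≤nimSum+total (x ∷ s) = head ∷ All.map (λ {y} → tail {y}) (2*pile≤nimSum+total s)
  where
  N = nimSum s
  T = total s
  head : 2 * x ≤ x ⊕ N + (x + T)
  head = begin
    2 * x               ≡⟨ cong (x +_) (+-identityʳ x) ⟩
    x + x               ≤⟨ +-monoˡ-≤ x (⊕-triangleˡ x N) ⟩
    (x ⊕ N + N) + x     ≤⟨ +-monoˡ-≤ x (+-monoʳ-≤ (x ⊕ N) (nimSum≤total s)) ⟩
    (x ⊕ N + T) + x     ≡⟨ trans (+-assoc (x ⊕ N) T x) (cong (x ⊕ N +_) (+-comm T x)) ⟩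
    x ⊕ N + (x + T)     ∎
  tail : ∀ {y} → 2 * y ≤ N + T → 2 * y ≤ x ⊕ N + (x + T)
  tail {y} 2y≤ = begin
    2 * y               ≤⟨ 2y≤ ⟩
    N + T               ≤⟨ +-monoˡ-≤ T (⊕-triangleʳ x N) ⟩
    (x ⊕ N + x) + T     ≡⟨ +-assoc (x ⊕ N) x T ⟩
    x ⊕ N + (x + T)     ∎

complete : ∀ {k} → Vec ℕ k → Vec ℕ (suc k)
complete s = nimSum s ∷ s

nimSum-complete : ∀ {k} (s : Vec ℕ k) → nimSum (complete s) ≡ 0
nimSum-complete s = ⊕-self (nimSum s)

nimSum≡0⇒≡complete : ∀ {k x} {s : Vec ℕ k} → nimSum (x ∷ s) ≡ 0 → x ∷ s ≡ complete s
nimSum≡0⇒≡complete x⊕N≡0 = cong (_∷ _) (⊕≡0⇒≡ x⊕N≡0)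

boxTuples-suc : ∀ k m → boxTuples (suc k) m ≡ cartesianProductWith _∷_ (upTo (suc m)) (boxTuples k m)
boxTuples-suc k m = concatMap≡cartesianProductWith _∷_ (upTo (suc m)) (boxTuples k m)

∈-boxTuples⁺ : ∀ {k m} {s : Vec ℕ k} → All (_≤ m) s → s ∈ boxTuples k m
∈-boxTuples⁺ []                      = here refl
∈-boxTuples⁺ {suc k} {m} (x≤m ∷ s≤m) = subst (_ ∈_) (sym (boxTuples-suc k m))
  (∈-cartesianProductWith⁺ _∷_ (∈-upTo⁺ (s≤s x≤m)) (∈-boxTuples⁺ s≤m))

∈-boxTuples⁻ : ∀ {k m} {s : Vec ℕ k} → s ∈ boxTuples k m → All (_≤ m) s
∈-boxTuples⁻ {zero}  {s = []} _ = []
∈-boxTuples⁻ {suc k} {m} {s} s∈box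
  with x , t , x∈ , t∈ , refl ← ∈-cartesianProductWith⁻ _∷_ (upTo (suc m)) (boxTuples k m)
                                   (subst (s ∈_) (boxTuples-suc k m) s∈box)
  = ≤-pred (∈-upTo⁻ x∈) ∷ ∈-boxTuples⁻ t∈

boxTuples-unique : ∀ k m → Unique (boxTuples k m)
boxTuples-unique zero    m = List.[] ∷ []
boxTuples-unique (suc k) m = subst Unique (sym (boxTuples-suc k m))
  (Unique.cartesianProductWith⁺ _∷_ ∷-injective (upTo⁺ (suc m)) (boxTuples-unique k m))

length-boxTuples : ∀ k m → length (boxTuples k m) ≡ suc m ^ k
length-boxTuples zero    m = refl
length-boxTuples (suc k) m = begin-equality
  length (boxTuples (suc k) m)                            ≡⟨ cong length (boxTuples-suc k m) ⟩
  length (cartesianProductWith _∷_ piles (boxTuples k m))  ≡⟨ length-cartesianProductWith _∷_ piles (boxTuples k m) ⟩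
  length piles * length (boxTuples k m)                   ≡⟨ cong₂ _*_ (length-upTo (suc m)) (length-boxTuples k m) ⟩
  suc m * suc m ^ k                                       ∎
  where piles = upTo (suc m)

length-filter-boxTuples-mono : ∀ {k M m p q} {P : Pred (Vec ℕ k) p} {Q : Pred (Vec ℕ k) q}
  (P? : Decidable P) (Q? : Decidable Q) →
  (∀ {s} → All (_≤ M) s → P s → All (_≤ m) s × Q s) →
  length (filter P? (boxTuples k M)) ≤ length (filter Q? (boxTuples k m))
length-filter-boxTuples-mono {k} {M} P? Q? P⇒Q =
  Unique∧⊆⇒length≤ (Unique.filter⁺ P? (boxTuples-unique k M)) λ s∈ →
    let s∈box , Ps = ∈-filter⁻ P? s∈
        s≤m , Qs   = P⇒Q (∈-boxTuples⁻ s∈box) Ps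
    in ∈-filter⁺ Q? (∈-boxTuples⁺ s≤m) Qs

isP-position? : ∀ {k} → Decidable (λ (p : Vec ℕ k) → nimSum p ≡ 0)
isP-position? p = nimSum p ≟ 0

isP-position?×total≤ : ∀ {k} t → Decidable (λ (p : Vec ℕ k) → nimSum p ≡ 0 × total p ≤ t)
isP-position?×total≤ t p = (nimSum p ≟ 0) ×-dec (total p ≤? t)

total≤k*m : ∀ {k m} {s : Vec ℕ k} → All (_≤ m) s → total s ≤ k * m
total≤k*m []          = z≤n
total≤k*m (x≤m ∷ s≤m) = +-mono-≤ x≤m (total≤k*m s≤m)

[2^f]^[k∸1]≤a : ∀ k f {m} → 2 ^ f ≤ suc m → (2 ^ f) ^ (k ∸ 1) ≤ a k m
[2^f]^[k∸1]≤a zero    f _ = ≤-refl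
[2^f]^[k∸1]≤a (suc k) f {m} 2^f≤1+m = begin
  (2 ^ f) ^ k                            ≡⟨ cong (_^ k) 1+M≡2^f ⟨
  suc M ^ k                              ≡⟨ length-boxTuples k M ⟨
  length (boxTuples k M)                 ≡⟨ length-map complete (boxTuples k M) ⟨
  length (map complete (boxTuples k M))  ≤⟨ Unique∧⊆⇒length≤ (Unique.map⁺ ∷-injectiveʳ (boxTuples-unique k M))
                                                              complete-box⊆P-positions ⟩
  a (suc k) m                            ∎
  where
  instance
    2^f≢0 : NonZero (2 ^ f)
    2^f≢0 = m^n≢0 2 f
  M = pred (2 ^ f)
  1+M≡2^f : suc M ≡ 2 ^ f
  1+M≡2^f = suc-pred (2 ^ f)
  M≤m : M ≤ m
  M≤m = ≤-pred (subst (_≤ suc m) (sym 1+M≡2^f) 2^f≤1+m)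
  complete-box⊆P-positions : map complete (boxTuples k M) ⊆ filter isP-position? (boxTuples (suc k) m)
  complete-box⊆P-positions v∈ with s , s∈box , refl ← ∈-map⁻ complete v∈ =
    ∈-filter⁺ isP-position? (∈-boxTuples⁺ (N≤m ∷ All.map (λ y≤M → ≤-trans y≤M M≤m) s≤M)) (nimSum-complete s)
    where
    s≤M = ∈-boxTuples⁻ s∈box
    N≤m : nimSum s ≤ m
    N≤m = ≤-pred (≤-trans (nimSum<2^ f (All.map (λ y≤M → subst (_ <_) 1+M≡2^f (s≤s y≤M)) s≤M)) 2^f≤1+m)

a≤[1+m]^[k∸1] : ∀ k m → a k m ≤ suc m ^ (k ∸ 1)
a≤[1+m]^[k∸1] zero    m = ≤-refl
a≤[1+m]^[k∸1] (suc k) m = begin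
  a (suc k) m                            ≤⟨ Unique∧⊆⇒length≤ (Unique.filter⁺ isP-position? (boxTuples-unique (suc k) m))
                                                              P-positions⊆complete-box ⟩
  length (map complete (boxTuples k m))  ≡⟨ length-map complete (boxTuples k m) ⟩
  length (boxTuples k m)                 ≡⟨ length-boxTuples k m ⟩
  suc m ^ k                              ∎
  where
  P-positions⊆complete-box : filter isP-position? (boxTuples (suc k) m) ⊆ map complete (boxTuples k m)
  P-positions⊆complete-box {_ ∷ s} v∈ =
    let v∈box , v≡0 = ∈-filter⁻ isP-position? v∈
    in subst (_∈ map complete (boxTuples k m)) (sym (nimSum≡0⇒≡complete v≡0))
             (∈-map⁺ complete (∈-boxTuples⁺ (All.tail (∈-boxTuples⁻ v∈box))))

a≤A : ∀ k .{{_ : NonZero k}} {M} n → k * M ≤ 2 * n → a k M ≤ A k n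
a≤A k {M} n kM≤2n =
  length-filter-boxTuples-mono {k} {M} {2 * n} isP-position? (isP-position?×total≤ (2 * n)) λ s≤M s≡0 →
  All.map (λ y≤M → ≤-trans y≤M (≤-trans (m≤n*m M k) kM≤2n)) s≤M ,
  s≡0 , ≤-trans (total≤k*m s≤M) kM≤2n

A≤a : ∀ k n → A k n ≤ a k n
A≤a k n =
  length-filter-boxTuples-mono {k} {2 * n} {n} (isP-position?×total≤ (2 * n)) isP-position? λ {s} _ (s≡0 , total≤2n) →
  All.map (λ 2y≤ → *-cancelˡ-≤ 2 (≤-trans 2y≤ (subst (λ N → N + total s ≤ 2 * n) (sym s≡0) total≤2n)))
          (2*pile≤nimSum+total s) ,
  s≡0

a≥2^⌊log₂[m+1]⌋ : ∀ k m → 2 ^ ((k ∸ 1) * ⌊log₂ (m + 1) ⌋) ≤ a k m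
a≥2^⌊log₂[m+1]⌋ k m = begin
  2 ^ ((k ∸ 1) * f)   ≡⟨ 2^[m*n]≡[2^n]^m (k ∸ 1) f ⟩
  (2 ^ f) ^ (k ∸ 1)   ≤⟨ [2^f]^[k∸1]≤a k f (subst (λ j → 2 ^ ⌊log₂ j ⌋ ≤ suc m) (+-comm 1 m) (2^⌊log₂[1+n]⌋≤1+n m)) ⟩
  a k m               ∎
  where f = ⌊log₂ (m + 1) ⌋

a≤2^⌈log₂[m+1]⌉ : ∀ k m → a k m ≤ 2 ^ ((k ∸ 1) * ⌈log₂ (m + 1) ⌉)
a≤2^⌈log₂[m+1]⌉ k m = begin
  a k m               ≤⟨ a≤[1+m]^[k∸1] k m ⟩
  suc m ^ (k ∸ 1)     ≤⟨ ^-monoˡ-≤ (k ∸ 1) (subst (_≤ 2 ^ c) (+-comm m 1) (n≤2^⌈log₂n⌉ (m + 1))) ⟩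
  (2 ^ c) ^ (k ∸ 1)   ≡⟨ 2^[m*n]≡[2^n]^m (k ∸ 1) c ⟨
  2 ^ ((k ∸ 1) * c)   ∎
  where c = ⌈log₂ (m + 1) ⌉

corollary9 : (k : ℕ) .{{_ : NonZero k}} (n : ℕ) →
    2 ^ ((k ∸ 1) * ⌊log₂ ((2 * n) / k + 1) ⌋) ≤ a k ((2 * n) / k)
    × a k ((2 * n) / k) ≤ A k n
    × A k n ≤ a k n
    × a k n ≤ 2 ^ ((k ∸ 1) * ⌈log₂ (n + 1) ⌉)
corollary9 k n =
  a≥2^⌊log₂[m+1]⌋ k M , a≤A k n k*M≤2n , A≤a k n , a≤2^⌈log₂[m+1]⌉ k n
  where
  M = (2 * n) / k
  k*M≤2n : k * M ≤ 2 * n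
  k*M≤2n = ≤-trans (≤-reflexive (*-comm k M)) (m/n*n≤m (2 * n) k)
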